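{- Define polynomials $P_k,Q_k$ by $P_0(t)=Q_0(t)=1$, $P_{k+1}(t)=tP_k(t)+P_k'(t)$ for $k\ge0$, and $Q_k(t)=P_k(t)+Q_{k-1}'(t)$ for $k\ge1$, and let $q_{k,0}=Q_k(0)$ denote the constant coefficient of $Q_k$. Then $q_{2n,0}=2^n\,n!$ for all $n=0,1,2,\dots$. -}

module Defs where

open import Data.Nat using (ℕ; zero; suc; _+_; _*_)
open import Data.List using (List; []; _∷_)

-- Polynomials with natural-number coefficients, as coefficient lists
-- (lowest degree first): a₀ ∷ a₁ ∷ … represents a₀ + a₁ t + …
-- (all coefficients of P_k, Q_k are nonnegative integers).
Poly : Set
Poly = List ℕ

one : Poly
one = 1 ∷ []

_⊕_ : Poly → Poly → Poly
[]       ⊕ q        = q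
(a ∷ p)  ⊕ []       = a ∷ p
(a ∷ p)  ⊕ (b ∷ q)  = (a + b) ∷ (p ⊕ q)

mulT : Poly → Poly
mulT p = 0 ∷ p

derivFrom : ℕ → Poly → Poly
derivFrom i []       = []
derivFrom i (a ∷ p)  = (i * a) ∷ derivFrom (suc i) p

deriv : Poly → Poly
deriv []       = []
deriv (a ∷ p)  = derivFrom 1 p

const : Poly → ℕ
const []       = 0
const (a ∷ p)  = a

P : ℕ → Poly
P zero    = one
P (suc k) = mulT (P k) ⊕ deriv (P k)

Q : ℕ → Poly
Q zero    = one
Q (suc k) = P (suc k) ⊕ deriv (Q k)

q0 : ℕ → ℕ
q0 k = const (Q k)

module Submission where

-- Write p k j and q k j for the coefficients of t^j in P_k and Q_k.
-- Unfolding Q_k = P_k + Q_{k-1}' repeatedly (and using deg Q_k ≤ k) gives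
--
--   j! q_{2r+j, j} = Σ_{u ≤ r} h(u+j, r-u),     h(j, r) = j! p_{2r+j, j},
--
-- so q_{2n,0} is the diagonal sum D n = Σ_{j ≤ n} h(j, n-j).  The recurrence
-- P_{k+1} = t P_k + P_k' shows that h satisfies the same recurrences as
-- (2r+j)! / (2^r r!), hence the closed form 2^r r! · h(j,r) = (2r+j)!
-- (the coefficient formula for Hermite polynomials).  Cancelling 2^r r!
-- yields two division-free recurrences h(j+1,r) = (2r+j+1) h(j,r) and
-- 2(r+1) h(j,r+1) = h(j+2,r).  Computing D(n+1) with each of them gives two
-- expressions whose comparison is D(n+1) = 2(n+1) D n, whence D n = 2^n n!.

open import Defs
open import Data.Nat using (ℕ; _*_; _^_; _!)
open import Relation.Binary.PropositionalEquality using (_≡_)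
open import Data.Nat using (zero; suc; _+_; _∸_; _≤_; _<_; z≤n; s≤s; NonZero)
open import Data.Nat.Properties
open import Data.List using ([]; _∷_)
open import Relation.Binary.PropositionalEquality using (refl; sym; trans; cong; cong₂; module ≡-Reasoning)
open import Data.Nat.Tactic.RingSolver using (solve-∀)

open ≡-Reasoning

coeff : ℕ → Poly → ℕ
coeff j       []      = 0
coeff zero    (a ∷ f) = a
coeff (suc j) (a ∷ f) = coeff j f

const≡coeff₀ : ∀ f → const f ≡ coeff 0 f
const≡coeff₀ []      = refl
const≡coeff₀ (a ∷ f) = refl

coeff-⊕ : ∀ j f g → coeff j (f ⊕ g) ≡ coeff j f + coeff j g
coeff-⊕ j       []      g       = refl
coeff-⊕ zero    (a ∷ f) []      = sym (+-identityʳ a)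
coeff-⊕ (suc j) (a ∷ f) []      = sym (+-identityʳ (coeff j f))
coeff-⊕ zero    (a ∷ f) (b ∷ g) = refl
coeff-⊕ (suc j) (a ∷ f) (b ∷ g) = coeff-⊕ j f g

coeff-derivFrom : ∀ i j f → coeff j (derivFrom i f) ≡ (i + j) * coeff j f
coeff-derivFrom i j       []      = sym (*-zeroʳ (i + j))
coeff-derivFrom i zero    (a ∷ f) = cong (_* a) (sym (+-identityʳ i))
coeff-derivFrom i (suc j) (a ∷ f) =
  trans (coeff-derivFrom (suc i) j f) (cong (_* coeff j f) (sym (+-suc i j)))

coeff-deriv : ∀ j f → coeff j (deriv f) ≡ suc j * coeff (suc j) f
coeff-deriv j []      = sym (*-zeroʳ (suc j))
coeff-deriv j (a ∷ f) = coeff-derivFrom 1 j f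

p : ℕ → ℕ → ℕ
p k j = coeff j (P k)

q : ℕ → ℕ → ℕ
q k j = coeff j (Q k)

p-suc-zero : ∀ k → p (suc k) 0 ≡ p k 1
p-suc-zero k = begin
  p (suc k) 0                ≡⟨ coeff-⊕ 0 (mulT (P k)) (deriv (P k)) ⟩
  0 + coeff 0 (deriv (P k))  ≡⟨ coeff-deriv 0 (P k) ⟩
  1 * p k 1                  ≡⟨ *-identityˡ (p k 1) ⟩
  p k 1                      ∎

p-suc-suc : ∀ k j → p (suc k) (suc j) ≡ p k j + (2 + j) * p k (2 + j)
p-suc-suc k j = trans (coeff-⊕ (suc j) (mulT (P k)) (deriv (P k)))
                      (cong (p k j +_) (coeff-deriv (suc j) (P k)))

q-suc : ∀ k j → q (suc k) j ≡ p (suc k) j + suc j * q k (suc j)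
q-suc k j = trans (coeff-⊕ j (P (suc k)) (deriv (Q k)))
                  (cong (p (suc k) j +_) (coeff-deriv j (Q k)))

p-vanish : ∀ k j → k < j → p k j ≡ 0
p-vanish zero    (suc j) _           = refl
p-vanish (suc k) (suc j) (s≤s k<j) = begin
  p (suc k) (suc j)                  ≡⟨ p-suc-suc k j ⟩
  p k j + (2 + j) * p k (2 + j)      ≡⟨ cong₂ (λ a b → a + (2 + j) * b) (p-vanish k j k<j)
                                              (p-vanish k (2 + j) (m<n⇒m<1+n (m<n⇒m<1+n k<j))) ⟩
  (2 + j) * 0                        ≡⟨ *-zeroʳ (2 + j) ⟩
  0                                  ∎

q-vanish : ∀ k j → k < j → q k j ≡ 0
q-vanish zero    (suc j) _           = refl
q-vanish (suc k) (suc j) (s≤s k<j) = begin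
  q (suc k) (suc j)                         ≡⟨ q-suc k (suc j) ⟩
  p (suc k) (suc j) + (2 + j) * q k (2 + j) ≡⟨ cong₂ (λ a b → a + (2 + j) * b) (p-vanish (suc k) (suc j) (s≤s k<j))
                                                     (q-vanish k (2 + j) (m<n⇒m<1+n (m<n⇒m<1+n k<j))) ⟩
  (2 + j) * 0                               ≡⟨ *-zeroʳ (2 + j) ⟩
  0                                         ∎

p-top : ∀ k → p k k ≡ 1
p-top zero    = refl
p-top (suc k) = begin
  p (suc k) (suc k)               ≡⟨ p-suc-suc k k ⟩
  p k k + (2 + k) * p k (2 + k)   ≡⟨ cong₂ (λ a b → a + (2 + k) * b) (p-top k) (p-vanish k (2 + k) (m<n⇒m<1+n (n<1+n k))) ⟩
  1 + (2 + k) * 0                 ≡⟨ cong suc (*-zeroʳ (2 + k)) ⟩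
  1                               ∎

q-top : ∀ k → q k k ≡ p k k
q-top zero    = refl
q-top (suc k) = begin
  q (suc k) (suc k)                         ≡⟨ q-suc k (suc k) ⟩
  p (suc k) (suc k) + (2 + k) * q k (2 + k) ≡⟨ cong (λ b → p (suc k) (suc k) + (2 + k) * b) (q-vanish k (2 + k) (m<n⇒m<1+n (n<1+n k))) ⟩
  p (suc k) (suc k) + (2 + k) * 0           ≡⟨ cong (p (suc k) (suc k) +_) (*-zeroʳ (2 + k)) ⟩
  p (suc k) (suc k) + 0                     ≡⟨ +-identityʳ _ ⟩
  p (suc k) (suc k)                         ∎

sumTo : ℕ → (ℕ → ℕ) → ℕ
sumTo zero    g = g 0
sumTo (suc N) g = g 0 + sumTo N (λ u → g (suc u))

infix 5 sumTo
syntax sumTo N (λ u → e) = Σ[ u ≤ N ] e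

sum-cong : ∀ N {g g′ : ℕ → ℕ} → (∀ u → u ≤ N → g u ≡ g′ u) → sumTo N g ≡ sumTo N g′
sum-cong zero    eq = eq 0 z≤n
sum-cong (suc N) eq = cong₂ _+_ (eq 0 z≤n) (sum-cong N (λ u u≤N → eq (suc u) (s≤s u≤N)))

sum-+ : ∀ N (g g′ : ℕ → ℕ) → (Σ[ u ≤ N ] (g u + g′ u)) ≡ sumTo N g + sumTo N g′
sum-+ zero    g g′ = refl
sum-+ (suc N) g g′ = begin
  (g 0 + g′ 0) + sumTo N (λ u → g (suc u) + g′ (suc u))
    ≡⟨ cong ((g 0 + g′ 0) +_) (sum-+ N (λ u → g (suc u)) (λ u → g′ (suc u))) ⟩
  (g 0 + g′ 0) + (sumTo N (λ u → g (suc u)) + sumTo N (λ u → g′ (suc u)))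
    ≡⟨ +-interchange (g 0) (g′ 0) _ _ ⟩
  sumTo (suc N) g + sumTo (suc N) g′ ∎
  where
  +-interchange : ∀ a b c d → (a + b) + (c + d) ≡ (a + c) + (b + d)
  +-interchange = solve-∀

sum-* : ∀ N a (g : ℕ → ℕ) → (Σ[ u ≤ N ] (a * g u)) ≡ a * sumTo N g
sum-* zero    a g = refl
sum-* (suc N) a g = trans (cong (a * g 0 +_) (sum-* N a (λ u → g (suc u))))
                          (sym (*-distribˡ-+ a (g 0) _))

sum-last : ∀ N (g : ℕ → ℕ) → sumTo (suc N) g ≡ sumTo N g + g (suc N)
sum-last zero    g = refl
sum-last (suc N) g = trans (cong (g 0 +_) (sum-last N (λ u → g (suc u))))
                           (sym (+-assoc (g 0) _ _))

-- h j r = j! p_{2r+j, j}: the scaled coefficients of P along the diagonals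
-- of fixed parity.  Their closed form is (2r+j)! / (2^r r!).
h : ℕ → ℕ → ℕ
h j r = j ! * p (2 * r + j) j

diagonal-step : ∀ r j → 2 * suc r + j ≡ 2 * r + (2 + j)
diagonal-step = solve-∀

index-shift : ∀ r j → 2 * suc r + j ≡ suc (2 * r + suc j)
index-shift r j = trans (diagonal-step r j) (+-suc (2 * r) (suc j))

factorial-distrib : ∀ j a b → j ! * (a + suc j * b) ≡ j ! * a + suc j ! * b
factorial-distrib j a b = begin
  j ! * (a + suc j * b)         ≡⟨ *-distribˡ-+ (j !) a (suc j * b) ⟩
  j ! * a + j ! * (suc j * b)   ≡⟨ cong (j ! * a +_) (sym (*-assoc (j !) (suc j) b)) ⟩
  j ! * a + j ! * suc j * b     ≡⟨ cong (λ c → j ! * a + c * b) (*-comm (j !) (suc j)) ⟩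
  j ! * a + suc j ! * b         ∎

-- Unfolding Q_k = P_k + Q_{k-1}' along a diagonal: the coefficient of t^j in
-- Q_{2r+j} collects the coefficients h(u+j, r-u) of the P's it is built from;
-- the unfolding stops at Q_j, whose top coefficient is that of P_j.
q-expansion : ∀ r j → j ! * q (2 * r + j) j ≡ Σ[ u ≤ r ] h (u + j) (r ∸ u)
q-expansion zero    j = cong (j ! *_) (q-top j)
q-expansion (suc r) j = begin
  j ! * q (2 * suc r + j) j                    ≡⟨ cong (λ k → j ! * q k j) (index-shift r j) ⟩
  j ! * q (suc K) j                            ≡⟨ cong (j ! *_) (q-suc K j) ⟩
  j ! * (p (suc K) j + suc j * q K (suc j))    ≡⟨ factorial-distrib j (p (suc K) j) (q K (suc j)) ⟩
  j ! * p (suc K) j + suc j ! * q K (suc j)    ≡⟨ cong₂ _+_ (cong (λ k → j ! * p k j) (sym (index-shift r j)))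
                                                           (q-expansion r (suc j)) ⟩
  h j (suc r) + (Σ[ u ≤ r ] h (u + suc j) (r ∸ u))
    ≡⟨ cong (h j (suc r) +_) (sum-cong r (λ u _ → cong (λ i → h i (r ∸ u)) (+-suc u j))) ⟩
  Σ[ u ≤ suc r ] h (u + j) (suc r ∸ u)         ∎
  where
  K : ℕ
  K = 2 * r + suc j

h-zero-suc : ∀ r → h 0 (suc r) ≡ h 1 r
h-zero-suc r = cong (1 *_) (trans (cong (λ k → p k 0) (index-shift r 0)) (p-suc-zero (2 * r + 1)))

h-suc-suc : ∀ j r → h (suc j) (suc r) ≡ suc j * h j (suc r) + h (2 + j) r
h-suc-suc j r = begin
  suc j ! * p (2 * suc r + suc j) (suc j)          ≡⟨ cong (λ k → suc j ! * p k (suc j)) (index-shift r (suc j)) ⟩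
  suc j ! * p (suc K) (suc j)                      ≡⟨ cong (suc j ! *_) (p-suc-suc K j) ⟩
  suc j ! * (p K j + (2 + j) * p K (2 + j))        ≡⟨ factorial-distrib (suc j) (p K j) (p K (2 + j)) ⟩
  suc j ! * p K j + h (2 + j) r                    ≡⟨ cong (_+ h (2 + j) r) (*-assoc (suc j) (j !) (p K j)) ⟩
  suc j * (j ! * p K j) + h (2 + j) r              ≡⟨ cong (λ k → suc j * (j ! * p k j) + h (2 + j) r) (sym (diagonal-step r j)) ⟩
  suc j * h j (suc r) + h (2 + j) r                ∎
  where
  K : ℕ
  K = 2 * r + (2 + j)

-- dfact r = 2^r r! = (2r)!!, the denominator in the closed form of h.
dfact : ℕ → ℕ
dfact r = 2 ^ r * r !

dfact-suc : ∀ r → dfact (suc r) ≡ 2 * suc r * dfact r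
dfact-suc r = reassoc (2 ^ r) r (r !)
  where
  reassoc : ∀ x r y → 2 * x * (suc r * y) ≡ 2 * suc r * (x * y)
  reassoc = solve-∀

dfact≢0 : ∀ r → NonZero (dfact r)
dfact≢0 r = m*n≢0 (2 ^ r) (r !) {{m^n≢0 2 r}} {{r !≢0}}

h-closed : ∀ r j → dfact r * h j r ≡ (2 * r + j) !
h-closed zero j = begin
  1 * (j ! * p j j)   ≡⟨ *-identityˡ _ ⟩
  j ! * p j j         ≡⟨ cong (j ! *_) (p-top j) ⟩
  j ! * 1             ≡⟨ *-identityʳ (j !) ⟩
  j !                 ∎
h-closed (suc r) zero = begin
  dfact (suc r) * h 0 (suc r)      ≡⟨ cong₂ _*_ (dfact-suc r) (h-zero-suc r) ⟩
  2 * suc r * dfact r * h 1 r      ≡⟨ *-assoc (2 * suc r) (dfact r) (h 1 r) ⟩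
  2 * suc r * (dfact r * h 1 r)    ≡⟨ cong₂ _*_ twice-suc (h-closed r 1) ⟩
  suc (2 * r + 1) * (2 * r + 1) !  ≡⟨ cong _! (sym (index-shift r 0)) ⟩
  (2 * suc r + 0) !                ∎
  where
  twice-suc : 2 * suc r ≡ suc (2 * r + 1)
  twice-suc = trans (sym (+-identityʳ (2 * suc r))) (index-shift r 0)
h-closed (suc r) (suc j) = begin
  dfact (suc r) * h (suc j) (suc r)
    ≡⟨ cong (dfact (suc r) *_) (h-suc-suc j r) ⟩
  dfact (suc r) * (suc j * h j (suc r) + h (2 + j) r)
    ≡⟨ cong (λ d → d * (suc j * h j (suc r) + h (2 + j) r)) (dfact-suc r) ⟩
  2 * suc r * dfact r * (suc j * h j (suc r) + h (2 + j) r)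
    ≡⟨ expand (2 * suc r) (dfact r) (suc j) (h j (suc r)) (h (2 + j) r) ⟩
  suc j * (2 * suc r * dfact r * h j (suc r)) + 2 * suc r * (dfact r * h (2 + j) r)
    ≡⟨ cong (λ d → suc j * (d * h j (suc r)) + 2 * suc r * (dfact r * h (2 + j) r)) (sym (dfact-suc r)) ⟩
  suc j * (dfact (suc r) * h j (suc r)) + 2 * suc r * (dfact r * h (2 + j) r)
    ≡⟨ cong₂ (λ a b → suc j * a + 2 * suc r * b) (h-closed (suc r) j) (h-closed r (2 + j)) ⟩
  suc j * K ! + 2 * suc r * (2 * r + (2 + j)) !
    ≡⟨ cong (λ k → suc j * K ! + 2 * suc r * k !) (sym (diagonal-step r j)) ⟩
  suc j * K ! + 2 * suc r * K !
    ≡⟨ sym (*-distribʳ-+ (K !) (suc j) (2 * suc r)) ⟩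
  (suc j + 2 * suc r) * K !
    ≡⟨ cong (_* K !) (trans (+-comm (suc j) (2 * suc r)) (+-suc (2 * suc r) j)) ⟩
  suc K !
    ≡⟨ cong _! (sym (+-suc (2 * suc r) j)) ⟩
  (2 * suc r + suc j) ! ∎
  where
  K : ℕ
  K = 2 * suc r + j
  expand : ∀ t d s a b → t * d * (s * a + b) ≡ s * (t * d * a) + t * (d * b)
  expand = solve-∀

-- Cancelling 2^r r! from the closed form gives two recurrences for h that
-- involve no division: raising j by one, and trading r+1 for j+2.
h-raise : ∀ j r → h (suc j) r ≡ (2 * r + suc j) * h j r
h-raise j r = *-cancelˡ-≡ _ _ (dfact r) {{dfact≢0 r}} (begin
  dfact r * h (suc j) r                 ≡⟨ h-closed r (suc j) ⟩
  (2 * r + suc j) !                     ≡⟨ cong _! (+-suc (2 * r) j) ⟩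
  suc (2 * r + j) * (2 * r + j) !       ≡⟨ cong₂ _*_ (sym (+-suc (2 * r) j)) (sym (h-closed r j)) ⟩
  (2 * r + suc j) * (dfact r * h j r)   ≡⟨ swap (2 * r + suc j) (dfact r) (h j r) ⟩
  dfact r * ((2 * r + suc j) * h j r)   ∎)
  where
  swap : ∀ a b c → a * (b * c) ≡ b * (a * c)
  swap = solve-∀

h-lower : ∀ j r → 2 * (suc r * h j (suc r)) ≡ h (2 + j) r
h-lower j r = *-cancelˡ-≡ _ _ (dfact r) {{dfact≢0 r}} (begin
  dfact r * (2 * (suc r * h j (suc r)))  ≡⟨ regroup (dfact r) r (h j (suc r)) ⟩
  2 * suc r * dfact r * h j (suc r)      ≡⟨ cong (_* h j (suc r)) (sym (dfact-suc r)) ⟩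
  dfact (suc r) * h j (suc r)            ≡⟨ h-closed (suc r) j ⟩
  (2 * suc r + j) !                      ≡⟨ cong _! (diagonal-step r j) ⟩
  (2 * r + (2 + j)) !                    ≡⟨ sym (h-closed r (2 + j)) ⟩
  dfact r * h (2 + j) r                  ∎)
  where
  regroup : ∀ d r x → d * (2 * (suc r * x)) ≡ 2 * suc r * d * x
  regroup = solve-∀

diagSum : ℕ → ℕ
diagSum n = Σ[ j ≤ n ] h j (n ∸ j)

weightedDiagSum : ℕ → ℕ
weightedDiagSum n = Σ[ j ≤ n ] (n ∸ j) * h j (n ∸ j)

-- D(n+1) via h-raise: each term h(j+1, n-j) is (n+1 + (n-j)) h(j, n-j).
diag-by-raise : ∀ n → diagSum (suc n) ≡ h 0 (suc n) + (suc n * diagSum n + weightedDiagSum n)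
diag-by-raise n = cong (h 0 (suc n) +_) (begin
  (Σ[ i ≤ n ] h (suc i) (n ∸ i))
    ≡⟨ sum-cong n raise-term ⟩
  (Σ[ i ≤ n ] (suc n * h i (n ∸ i) + (n ∸ i) * h i (n ∸ i)))
    ≡⟨ sum-+ n (λ i → suc n * h i (n ∸ i)) (λ i → (n ∸ i) * h i (n ∸ i)) ⟩
  (Σ[ i ≤ n ] suc n * h i (n ∸ i)) + weightedDiagSum n
    ≡⟨ cong (_+ weightedDiagSum n) (sum-* n (suc n) (λ i → h i (n ∸ i))) ⟩
  suc n * diagSum n + weightedDiagSum n ∎)
  where
  weight : ∀ {i} → i ≤ n → 2 * (n ∸ i) + suc i ≡ suc n + (n ∸ i)
  weight {i} i≤n = trans (rearrange (n ∸ i) i) (cong (λ m → suc m + (n ∸ i)) (m+[n∸m]≡n i≤n))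
    where
    rearrange : ∀ d i → 2 * d + suc i ≡ suc (i + d) + d
    rearrange = solve-∀
  raise-term : ∀ i → i ≤ n → h (suc i) (n ∸ i) ≡ suc n * h i (n ∸ i) + (n ∸ i) * h i (n ∸ i)
  raise-term i i≤n = trans (h-raise i (n ∸ i))
    (trans (cong (_* h i (n ∸ i)) (weight i≤n)) (*-distribʳ-+ (h i (n ∸ i)) (suc n) (n ∸ i)))

-- D(n+1) via h-lower: the terms j ≥ 2 of D(n+1) are 2(n+1-j') h(j', n+1-j')
-- for j' = j - 2, and the terms j = 0, 1 agree by h-zero-suc.
diag-by-lower : ∀ n → diagSum (suc n) ≡ 2 * h 0 (suc n) + 2 * weightedDiagSum n
diag-by-lower zero = trans (cong (h 0 1 +_) (sym (h-zero-suc 0))) (double (h 0 1))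
  where
  double : ∀ x → x + x ≡ 2 * x + 2 * 0
  double = solve-∀
diag-by-lower (suc m) = begin
  h₀ + (h 1 (suc m) + (Σ[ i ≤ m ] h (2 + i) (m ∸ i)))
    ≡⟨ cong₂ (λ a b → h₀ + (a + b)) (sym (h-zero-suc (suc m))) lowered-sum ⟩
  h₀ + (h₀ + 2 * W)
    ≡⟨ cong (λ w → h₀ + (h₀ + 2 * w)) (sym weighted-last-vanishes) ⟩
  h₀ + (h₀ + 2 * weightedDiagSum (suc m))
    ≡⟨ double h₀ (weightedDiagSum (suc m)) ⟩
  2 * h₀ + 2 * weightedDiagSum (suc m) ∎
  where
  h₀ W : ℕ
  h₀ = h 0 (2 + m)
  W  = Σ[ i ≤ m ] (suc m ∸ i) * h i (suc m ∸ i)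
  lowered-sum : (Σ[ i ≤ m ] h (2 + i) (m ∸ i)) ≡ 2 * W
  lowered-sum = trans (sum-cong m (λ i i≤m →
      trans (sym (h-lower i (m ∸ i))) (cong (λ s → 2 * (s * h i s)) (sym (+-∸-assoc 1 i≤m)))))
    (sum-* m 2 (λ i → (suc m ∸ i) * h i (suc m ∸ i)))
  weighted-last-vanishes : weightedDiagSum (suc m) ≡ W
  weighted-last-vanishes = begin
    weightedDiagSum (suc m)                 ≡⟨ sum-last m (λ i → (suc m ∸ i) * h i (suc m ∸ i)) ⟩
    W + (m ∸ m) * h (suc m) (m ∸ m)         ≡⟨ cong (λ z → W + z * h (suc m) (m ∸ m)) (n∸n≡0 m) ⟩
    W + 0                                   ≡⟨ +-identityʳ W ⟩
    W                                       ∎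
  double : ∀ x y → x + (x + 2 * y) ≡ 2 * x + 2 * y
  double = solve-∀

-- Comparing the two expressions: 2 D(n+1) = 2(n+1) D n + D(n+1).
diag-rec : ∀ n → diagSum (suc n) ≡ 2 * suc n * diagSum n
diag-rec n = +-cancelʳ-≡ A _ _ (begin
  A + A                                       ≡⟨ cong₂ _+_ (diag-by-raise n) (diag-by-raise n) ⟩
  (h₀ + (s * D + X)) + (h₀ + (s * D + X))     ≡⟨ regroup h₀ s D X ⟩
  2 * s * D + (2 * h₀ + 2 * X)                ≡⟨ cong (2 * s * D +_) (sym (diag-by-lower n)) ⟩
  2 * s * D + A                               ∎)
  where
  A D X h₀ s : ℕ
  A  = diagSum (suc n)
  D  = diagSum n
  X  = weightedDiagSum n
  h₀ = h 0 (suc n)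
  s  = suc n
  regroup : ∀ a s d x → (a + (s * d + x)) + (a + (s * d + x)) ≡ 2 * s * d + (2 * a + 2 * x)
  regroup = solve-∀

diag-closed : ∀ n → diagSum n ≡ 2 ^ n * n !
diag-closed zero    = refl
diag-closed (suc n) = begin
  diagSum (suc n)              ≡⟨ diag-rec n ⟩
  2 * suc n * diagSum n        ≡⟨ cong (2 * suc n *_) (diag-closed n) ⟩
  2 * suc n * (2 ^ n * n !)    ≡⟨ regroup (suc n) (2 ^ n) (n !) ⟩
  2 ^ suc n * suc n !          ∎
  where
  regroup : ∀ s x y → 2 * s * (x * y) ≡ (2 * x) * (s * y)
  regroup = solve-∀

corollary1 : (n : ℕ) → q0 (2 * n) ≡ 2 ^ n * n !
corollary1 n = begin
  q0 (2 * n)                              ≡⟨ const≡coeff₀ (Q (2 * n)) ⟩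
  q (2 * n) 0                             ≡⟨ sym (*-identityˡ _) ⟩
  0 ! * q (2 * n) 0                       ≡⟨ cong (λ k → 0 ! * q k 0) (sym (+-identityʳ (2 * n))) ⟩
  0 ! * q (2 * n + 0) 0                   ≡⟨ q-expansion n 0 ⟩
  (Σ[ u ≤ n ] h (u + 0) (n ∸ u))          ≡⟨ sum-cong n (λ u _ → cong (λ j → h j (n ∸ u)) (+-identityʳ u)) ⟩
  diagSum n                               ≡⟨ diag-closed n ⟩
  2 ^ n * n !                             ∎
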